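{- Let $k\ge 2$ be an integer. For every integer $n\ge 1$, $$ E_{n+1|k}(q)=\sum_{m=1}^{\lfloor n/k\rfloor}\begin{bmatrix} n\\ mk-1\end{bmatrix} q^{\,n-mk+1}\,E_{mk-1|k}(q)\,E_{n-mk+1|k}(q)\;+\;\chi(k\nmid n)\,E_{n|k}(q), $$ with the boundary condition $E_{0|k}(q)=1$.
   Context: For a permutation $\pi=a_1a_2\ldots a_n$ of $\{1,\ldots,n\}$, its descent set is $\mathrm{Des}(\pi)=\{i: 1\le i<n,\ a_i>a_{i+1}\}$ and $\mathrm{inv}(\pi)$ is the number of pairs $i<j$ with $a_i>a_j$. The generalized $q$-Euler number is $E_{n|k}(q)=\sum_{\pi} q^{\mathrm{inv}(\pi)}$, the sum over all permutations $\pi$ of $\{1,\ldots,n\}$ with $\mathrm{Des}(\pi)=\{k,2k,3k,\ldots\}\cap\{1,\ldots,n-1\}$; $E_{0|k}(q)=1$. Here $[j]=1+q+\cdots+q^{j-1}$, $[j]!=[j][j-1]\cdots[1]$, and the Gaussian polynomial is $\begin{bmatrix} n\\ j\end{bmatrix}=\frac{[n]!}{[j]![n-j]!}$ for $0\le j\le n$, and $0$ if $j>n$. $\chi(P)$ is $1$ if statement $P$ is true and $0$ otherwise. -}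

module Defs where

open import Level using (0ℓ)
open import Algebra.Bundles using (CommutativeSemiring)
open import Data.Bool using (Bool; true; false; if_then_else_; _∧_; not)
open import Data.Nat using (ℕ; zero; suc; _<ᵇ_; _≡ᵇ_; _∸_; _/_; NonZero)
  renaming (_+_ to _+ℕ_; _*_ to _*ℕ_)
open import Data.Nat.Divisibility using (_∣?_)
open import Data.List using (List; []; _∷_; map; concatMap; upTo; foldr)
open import Data.Bool.ListAction using (any)
open import Relation.Nullary.Decidable using (⌊_⌋)

-- Permutations of {0,…,n-1} (the values 0..n-1 instead of 1..n; this
-- changes neither descents nor inversions), enumerated as all length-n
-- sequences over {0,…,n-1} with no repeated entry.

seqs : ℕ → ℕ → List (List ℕ)
seqs n zero    = [] ∷ []
seqs n (suc m) = concatMap (λ x → map (x ∷_) (seqs n m)) (upTo n)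

distinct : List ℕ → Bool
distinct []      = true
distinct (x ∷ l) = not (any (λ y → x ≡ᵇ y) l) ∧ distinct l

filterB : {A : Set} → (A → Bool) → List A → List A
filterB p []      = []
filterB p (x ∷ l) = if p x then x ∷ filterB p l else filterB p l

perms : ℕ → List (List ℕ)
perms n = filterB distinct (seqs n n)

-- Des(π) = {k,2k,…} ∩ {1,…,n-1}: for every position i (1-indexed)
-- with 1 ≤ i < n, a_i > a_{i+1} iff k ∣ i.
-- descOK k i l checks this for l = a_i a_{i+1} …
boolEq : Bool → Bool → Bool
boolEq true  b = b
boolEq false b = not b

descOK : ℕ → ℕ → List ℕ → Bool
descOK k i []            = true
descOK k i (a ∷ [])      = true
descOK k i (a ∷ b ∷ l)   = boolEq (b <ᵇ a) ⌊ k ∣? i ⌋ ∧ descOK k (suc i) (b ∷ l)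

hasDesSet : ℕ → List ℕ → Bool
hasDesSet k π = descOK k 1 π

countB : {A : Set} → (A → Bool) → List A → ℕ
countB p []      = 0
countB p (x ∷ l) = (if p x then 1 else 0) +ℕ countB p l

inv : List ℕ → ℕ
inv []      = 0
inv (a ∷ l) = countB (λ b → b <ᵇ a) l +ℕ inv l

-- q-analogues, evaluated in an arbitrary commutative semiring R at an
-- arbitrary element q.  An identity holding for all (R, q) is exactly a
-- polynomial identity in ℕ[q] (take R = ℕ[q], q the indeterminate).

module _ (R : CommutativeSemiring 0ℓ 0ℓ) where
  open CommutativeSemiring R

  pow : Carrier → ℕ → Carrier
  pow q zero    = 1#
  pow q (suc n) = q * pow q n

  sumR : List Carrier → Carrier
  sumR = foldr _+_ 0#

  -- generalized q-Euler number E_{n|k}(q); E_{0|k}(q) = 1 since perms 0 = [ [] ]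
  qEuler : Carrier → ℕ → ℕ → Carrier
  qEuler q n k = sumR (map (λ π → pow q (inv π)) (filterB (hasDesSet k) (perms n)))

  qInt : Carrier → ℕ → Carrier
  qInt q zero    = 0#
  qInt q (suc j) = 1# + q * qInt q j

  qFact : Carrier → ℕ → Carrier
  qFact q zero    = 1#
  qFact q (suc j) = qInt q (suc j) * qFact q j

  -- Gaussian polynomial [n choose j] (0 if j > n), via the q-Pascal rule
  -- [n+1 choose j+1] = [n choose j] + q^{j+1} [n choose j+1]
  -- (the unique polynomial with [j]! [n-j]! [n choose j] = [n]!).
  gauss : Carrier → ℕ → ℕ → Carrier
  gauss q zero    zero    = 1#
  gauss q zero    (suc j) = 0#
  gauss q (suc n) zero    = 1#
  gauss q (suc n) (suc j) = gauss q n j + pow q (suc j) * gauss q n (suc j)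

  chiB : Bool → Carrier
  chiB true  = 1#
  chiB false = 0#

  rhs21 : Carrier → (n k : ℕ) → .{{NonZero k}} → Carrier
  rhs21 q n k =
    sumR (map (λ m → gauss q n (m *ℕ k ∸ 1) * pow q (n ∸ m *ℕ k +ℕ 1)
                       * qEuler q (m *ℕ k ∸ 1) k * qEuler q (n ∸ m *ℕ k +ℕ 1) k)
              (map suc (upTo (n / k))))
    + chiB (not ⌊ k ∣? n ⌋) * qEuler q n k

{-# OPTIONS --safe #-}
-- Every permutation of {0,…,n} arises exactly once by inserting the maximum n into a permutation
-- σ of {0,…,n−1} at some position p ≤ n, which creates n − p new inversions.  For the descent set
-- {k, 2k, …} the entry n needs an ascent on its left and a descent on its right, so either p = n
-- (possible iff k ∤ n) or p + 1 = mk; then σ splits into a prefix of length mk − 1 and a suffix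
-- which must both have descent sets {k, 2k, …} (the suffix starts at position mk + 1 ≡ 1 mod k).
-- Summing q^inv σ over the σ whose prefix and suffix have these descent sets gives
-- [n choose p] E_p E_{n−p}.
-- This q-binomial shuffle identity holds for any weights f, g of prefix and suffix that depend
-- only on relative order, and is proved by inserting the maximum once more, into the prefix or
-- into the suffix: the two cases give the two terms of the q-Pascal rule
-- [M+1 choose a] = q^b [M choose a−1] + [M choose a]  (a + b = M + 1).
module Submission where

open import Defs
open import Level using (0ℓ)
open import Algebra.Bundles using (CommutativeSemiring)
open import Data.Bool using (Bool; true; false; not; _∧_; T)
open import Data.Bool.ListAction using (any)
open import Data.Bool.Properties using (T-∧; T-≡; ∧-assoc; ∧-comm; ∧-identityʳ; ∧-zeroʳ)
open import Data.Nat
  using (ℕ; zero; suc; _∸_; _≤_; _<_; _<ᵇ_; _≡ᵇ_; z≤n; s≤s; NonZero)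
  renaming (_+_ to _+ℕ_; _*_ to _*ℕ_)
import Data.Nat.Properties as ℕₚ
open import Data.Nat.ListAction using (sum)
open import Data.List
  using (List; []; _∷_; [_]; _++_; _∷ʳ_; length; map; concatMap; replicate; take; drop; upTo; filterᵇ;
         cartesianProduct; cartesianProductWith)
import Data.List.Properties as Listₚ
open import Data.List.Membership.Propositional using (_∈_; _∉_)
open import Data.List.Membership.Propositional.Properties
  using (∈-∃++; ∈-upTo⁺; ∈-upTo⁻; ∈-map⁺; ∈-map⁻; ∈-filter⁺; ∈-filter⁻;
         ∈-cartesianProduct⁺; ∈-cartesianProduct⁻;
         ∈-cartesianProductWith⁺; ∈-cartesianProductWith⁻)
open import Data.List.Membership.DecPropositional ℕₚ._≟_ using (_∈?_)
open import Data.List.Relation.Unary.Any using (here; there)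
open import Data.List.Relation.Unary.All as All using (All; []; _∷_)
open import Data.List.Relation.Unary.All.Properties using (¬Any⇒All¬; All¬⇒¬Any; map⁺; take⁺; drop⁺)
open import Data.List.Relation.Unary.Unique.Propositional using (Unique; []; _∷_)
import Data.List.Relation.Unary.Unique.Propositional.Properties as Uniqueₚ
open import Data.List.Relation.Binary.Permutation.Propositional
  using (_↭_; ↭-refl; ↭-sym; ↭-prep; ↭-swap; ↭-trans; ↭⇒↭ₛ; ↭⇒↭ₛ′)
open import Data.List.Relation.Binary.Permutation.Propositional.Properties
  using (All-resp-↭; shift; ↭-length) renaming (map⁺ to ↭-map⁺)
import Data.List.Relation.Binary.Permutation.Setoid.Properties as Permₛ
open Permₛ using (foldr-commMonoid)
open import Data.List.Membership.Propositional.Properties.WithK using (unique∧set⇒bag)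
open import Data.List.Relation.Binary.BagAndSetEquality using (∼bag⇒↭)
open import Data.Product using (_×_; _,_; ∃₂; uncurry)
open import Data.Sum using (inj₁; inj₂)
open import Function using (_∘_; _$_; Equivalence; mk⇔)
open import Relation.Nullary using (¬_; yes; no; contradiction)
open import Relation.Nullary.Decidable using (T?; ⌊_⌋)
open import Data.Nat.DivMod
  using (_/_; _%_; 0/n≡0; m/n*n≡m; m/n*n≤m; /-congˡ; +-distrib-/-∣ʳ; m<n⇒m/n≡0; m*n/n≡m; m%n<n;
         m≡m%n+[m/n]*n)
open import Data.Nat.Divisibility
  using (_∣_; _∣?_; divides; n∣m*n; ∣m+n∣m⇒∣n; ∣m∣n⇒∣m+n; ∣1⇒≡1)
open import Relation.Binary.PropositionalEquality
  using (_≡_; _≢_; refl; sym; trans; cong; cong₂; subst; module ≡-Reasoning)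
  renaming (setoid to ≡-setoid)

<⇒<ᵇ≡true : ∀ {m n} → m < n → (m <ᵇ n) ≡ true
<⇒<ᵇ≡true m<n = T-≡ .Equivalence.to (ℕₚ.<⇒<ᵇ m<n)

>⇒<ᵇ≡false : ∀ {m n} → n < m → (m <ᵇ n) ≡ false
>⇒<ᵇ≡false {m} {n} n<m with m <ᵇ n in eq
... | true  = contradiction (ℕₚ.<ᵇ⇒< m n (subst T (sym eq) _)) (ℕₚ.<⇒≯ n<m)
... | false = refl

∣?-suc : ∀ {k} → 2 ≤ k → ∀ j → ⌊ k ∣? suc j ⌋ ∧ not ⌊ k ∣? j ⌋ ≡ ⌊ k ∣? suc j ⌋
∣?-suc {k} 2≤k j with k ∣? suc j | k ∣? j
... | no  _      | _        = refl
... | yes _      | no  _    = refl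
... | yes k∣1+j | yes k∣j =
  contradiction (∣1⇒≡1 (∣m+n∣m⇒∣n (subst (k ∣_) (ℕₚ.+-comm 1 j) k∣1+j) k∣j))
                (λ k≡1 → ℕₚ.<-irrefl (sym k≡1) 2≤k)

∣?-periodic : ∀ {k c} i → k ∣ c → ⌊ k ∣? c +ℕ i ⌋ ≡ ⌊ k ∣? i ⌋
∣?-periodic {k} {c} i k∣c with k ∣? c +ℕ i | k ∣? i
... | yes _     | yes _   = refl
... | no  _     | no  _   = refl
... | yes k∣c+i | no  k∤i = contradiction (∣m+n∣m⇒∣n k∣c+i k∣c) k∤i
... | no  k∤c+i | yes k∣i = contradiction (∣m∣n⇒∣m+n k∣c k∣i) k∤c+i

m∸[n∸1]≡m∸n+1 : ∀ {m n} → 1 ≤ n → n ≤ m → m ∸ (n ∸ 1) ≡ m ∸ n +ℕ 1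
m∸[n∸1]≡m∸n+1 {m} {suc n} _ n<m = trans (ℕₚ.+-∸-assoc 1 n<m) (ℕₚ.+-comm 1 (m ∸ suc n))

[r+c*k]/k≡c : ∀ {r c k} .{{_ : NonZero k}} → r < k → (r +ℕ c *ℕ k) / k ≡ c
[r+c*k]/k≡c {r} {c} {k} r<k =
  trans (+-distrib-/-∣ʳ r (n∣m*n c)) (cong₂ _+ℕ_ (m<n⇒m/n≡0 r<k) (m*n/n≡m c k))

suc-/-∣ : ∀ {k n} .{{_ : NonZero k}} → k ∣ suc n → suc n / k ≡ suc (n / k)
suc-/-∣ {suc k} {n} (divides (suc c) 1+n≡) =
  trans (/-congˡ 1+n≡) (trans (m*n/n≡m (suc c) (suc k))
    (cong suc (sym (trans (/-congˡ (ℕₚ.suc-injective 1+n≡)) ([r+c*k]/k≡c ℕₚ.≤-refl)))))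

suc-/-∤ : ∀ {k n} .{{_ : NonZero k}} → ¬ k ∣ suc n → suc n / k ≡ n / k
suc-/-∤ {k} {n} k∤1+n = trans (/-congˡ 1+n≡) ([r+c*k]/k≡c 1+r<k)
  where
  1+n≡ : suc n ≡ suc (n % k) +ℕ n / k *ℕ k
  1+n≡ = cong suc (m≡m%n+[m/n]*n n k)
  1+r<k : suc (n % k) < k
  1+r<k = ℕₚ.≤∧≢⇒< (m%n<n n k) λ 1+r≡k →
    k∤1+n (divides (suc (n / k)) (trans 1+n≡ (cong (_+ℕ n / k *ℕ k) 1+r≡k)))

-- Inserting an element into a list

-- Positions past the end append x.
insertAt : ∀ {A : Set} → ℕ → A → List A → List A
insertAt zero    x σ       = x ∷ σ
insertAt (suc p) x []      = x ∷ []
insertAt (suc p) x (y ∷ σ) = y ∷ insertAt p x σ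

insertAt-↭ : ∀ {A : Set} p (x : A) σ → insertAt p x σ ↭ x ∷ σ
insertAt-↭ zero    x σ       = ↭-refl
insertAt-↭ (suc p) x []      = ↭-refl
insertAt-↭ (suc p) x (y ∷ σ) = ↭-trans (↭-prep y (insertAt-↭ p x σ)) (↭-swap y x ↭-refl)

insertAt-++ : ∀ {A : Set} (x : A) u v → insertAt (length u) x (u ++ v) ≡ u ++ x ∷ v
insertAt-++ x []      v = refl
insertAt-++ x (y ∷ u) v = cong (y ∷_) (insertAt-++ x u v)

insertAt-length : ∀ {A : Set} (x : A) σ → insertAt (length σ) x σ ≡ σ ∷ʳ x
insertAt-length x σ =
  trans (cong (insertAt (length σ) x) (sym (Listₚ.++-identityʳ σ))) (insertAt-++ x σ [])

insertAt-injective : ∀ {A : Set} {x : A} {p p′ σ τ} → x ∉ σ → x ∉ τ →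
                     p ≤ length σ → p′ ≤ length τ → insertAt p x σ ≡ insertAt p′ x τ → p ≡ p′ × σ ≡ τ
insertAt-injective {p = zero}  {zero}                _   _   _ _ refl = refl , refl
insertAt-injective {p = zero}  {suc _} {τ = _ ∷ _}   _   x∉τ _ _ refl = contradiction (here refl) x∉τ
insertAt-injective {p = suc _} {zero}  {_ ∷ _}       x∉σ _   _ _ refl = contradiction (here refl) x∉σ
insertAt-injective {p = suc p} {suc p′} {y ∷ σ} {_ ∷ τ} x∉yσ x∉yτ (s≤s p≤) (s≤s p′≤) eq
  with refl , eq′ ← Listₚ.∷-injective eq
  with refl , refl ← insertAt-injective (x∉yσ ∘ there) (x∉yτ ∘ there) p≤ p′≤ eq′ = refl , refl

map-insertAt : ∀ {A B : Set} (f : A → B) p x σ → map f (insertAt p x σ) ≡ insertAt p (f x) (map f σ)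
map-insertAt f zero    x σ       = refl
map-insertAt f (suc p) x []      = refl
map-insertAt f (suc p) x (y ∷ σ) = cong (f y ∷_) (map-insertAt f p x σ)

take-insertAt-≤ : ∀ {A : Set} {p a} (x : A) σ → p ≤ a →
                  take (suc a) (insertAt p x σ) ≡ insertAt p x (take a σ)
take-insertAt-≤ {p = zero}                x σ       _         = refl
take-insertAt-≤ {p = suc p} {suc a} x []      _         = refl
take-insertAt-≤ {p = suc p} {suc a} x (y ∷ σ) (s≤s p≤a) = cong (y ∷_) (take-insertAt-≤ x σ p≤a)

drop-insertAt-≤ : ∀ {A : Set} {p a} (x : A) σ → p ≤ a → drop (suc a) (insertAt p x σ) ≡ drop a σ
drop-insertAt-≤ {p = zero}                x σ       _         = refl
drop-insertAt-≤ {p = suc p} {suc a} x []      _         = refl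
drop-insertAt-≤ {p = suc p} {suc a} x (y ∷ σ) (s≤s p≤a) = drop-insertAt-≤ x σ p≤a

take-insertAt-+ : ∀ {A : Set} a j (x : A) σ → a ≤ length σ → take a (insertAt (a +ℕ j) x σ) ≡ take a σ
take-insertAt-+ zero    j x σ       _         = refl
take-insertAt-+ (suc a) j x (y ∷ σ) (s≤s a≤σ) = cong (y ∷_) (take-insertAt-+ a j x σ a≤σ)

drop-insertAt-+ : ∀ {A : Set} a j (x : A) σ → a ≤ length σ →
                  drop a (insertAt (a +ℕ j) x σ) ≡ insertAt j x (drop a σ)
drop-insertAt-+ zero    j x σ       _         = refl
drop-insertAt-+ (suc a) j x (y ∷ σ) (s≤s a≤σ) = drop-insertAt-+ a j x σ a≤σ

-- Permutations as iterated insertions of the maximum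

Unique-resp-↭ : ∀ {A : Set} {xs ys : List A} → xs ↭ ys → Unique xs → Unique ys
Unique-resp-↭ {A} xs↭ys = Permₛ.Unique-resp-↭ (≡-setoid A) (↭⇒↭ₛ xs↭ys)

Unique-map⁺-on : ∀ {A B : Set} {f : A → B} {xs} →
                 (∀ {x y} → x ∈ xs → y ∈ xs → f x ≡ f y → x ≡ y) → Unique xs → Unique (map f xs)
Unique-map⁺-on _   []            = []
Unique-map⁺-on inj (x∉xs ∷ xs!) =
  map⁺ (All.tabulate λ y∈xs fx≡fy → All.lookup x∉xs y∈xs (inj (here refl) (there y∈xs) fx≡fy))
  ∷ Unique-map⁺-on (λ x∈ y∈ → inj (there x∈) (there y∈)) xs!

record IsPermutation (n : ℕ) (σ : List ℕ) : Set where
  constructor isPermutation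
  field
    length≡ : length σ ≡ n
    bounded : All (_< n) σ
    unique  : Unique σ

All-<-suc⇒< : ∀ {n σ} → All (_< suc n) σ → All (n ≢_) σ → All (_< n) σ
All-<-suc⇒< σ< σ≢ =
  All.zipWith (λ (x<1+n , n≢x) → ℕₚ.≤∧≢⇒< (ℕₚ.≤-pred x<1+n) (n≢x ∘ sym)) (σ< , σ≢)

split-at-max : ∀ {n σ} → Unique σ → All (_< suc n) σ → n ∈ σ →
             ∃₂ λ u w → σ ≡ u ++ n ∷ w × Unique (u ++ w) × All (_< n) (u ++ w)
split-at-max {n} σ! σ< n∈σ with u , w , refl ← ∈-∃++ n∈σ
  with n≢uw ∷ uw! ← Unique-resp-↭ (shift n u w) σ!
  with _ ∷ uw< ← All-resp-↭ (shift n u w) σ< =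
  u , w , refl , uw! , All-<-suc⇒< uw< n≢uw

Unique-bounded⇒length≤ : ∀ {n σ} → Unique σ → All (_< n) σ → length σ ≤ n
Unique-bounded⇒length≤ {zero}  {[]}    _ _        = z≤n
Unique-bounded⇒length≤ {zero}  {_ ∷ _} _ (() ∷ _)
Unique-bounded⇒length≤ {suc n} {σ}     σ! σ< with n ∈? σ
... | no n∉σ = ℕₚ.m≤n⇒m≤1+n (Unique-bounded⇒length≤ σ! (All-<-suc⇒< σ< (¬Any⇒All¬ σ n∉σ)))
... | yes n∈σ with u , w , refl , uw! , uw< ← split-at-max σ! σ< n∈σ =
  subst (_≤ suc n) (sym (↭-length (shift n u w))) (s≤s (Unique-bounded⇒length≤ uw! uw<))

bounded⇒∉ : ∀ {n σ} → All (_< n) σ → n ∉ σ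
bounded⇒∉ σ< = All¬⇒¬Any (All.map (λ x<n n≡x → ℕₚ.<-irrefl (sym n≡x) x<n) σ<)

insertions : ℕ → List (List ℕ)
insertions zero    = [ [] ]
insertions (suc n) = map (uncurry λ p σ → insertAt p n σ) (cartesianProduct (upTo (suc n)) (insertions n))

∈-insertions⁻ : ∀ {n σ} → σ ∈ insertions n → IsPermutation n σ
∈-insertions⁻ {zero} (here refl) = isPermutation refl [] []
∈-insertions⁻ {suc n} σ∈ with (p , τ) , pτ∈ , refl ← ∈-map⁻ _ σ∈
  with _ , τ∈ ← ∈-cartesianProduct⁻ (upTo (suc n)) (insertions n) pτ∈
  with isPermutation τ-len τ< τ! ← ∈-insertions⁻ τ∈ =
  isPermutation (trans (↭-length (insertAt-↭ p n τ)) (cong suc τ-len))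
                (All-resp-↭ (↭-sym (insertAt-↭ p n τ)) (ℕₚ.≤-refl ∷ All.map ℕₚ.m<n⇒m<1+n τ<))
                (Unique-resp-↭ (↭-sym (insertAt-↭ p n τ)) (¬Any⇒All¬ τ (bounded⇒∉ τ<) ∷ τ!))

∈-insertions⁺ : ∀ {n σ} → IsPermutation n σ → σ ∈ insertions n
∈-insertions⁺ {zero} {[]} _ = here refl
∈-insertions⁺ {suc n} {σ} (isPermutation σ-len σ< σ!) with n ∈? σ
... | no n∉σ = contradiction (subst (_≤ n) σ-len
                 (Unique-bounded⇒length≤ σ! (All-<-suc⇒< σ< (¬Any⇒All¬ σ n∉σ)))) ℕₚ.1+n≰n
... | yes n∈σ with u , w , refl , uw! , uw< ← split-at-max σ! σ< n∈σ =
  subst (_∈ insertions (suc n)) (insertAt-++ n u w)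
    (∈-map⁺ _ (∈-cartesianProduct⁺ (∈-upTo⁺ (s≤s u≤n))
                                   (∈-insertions⁺ (isPermutation uw-len uw< uw!))))
  where
  uw-len : length (u ++ w) ≡ n
  uw-len = ℕₚ.suc-injective (trans (sym (↭-length (shift n u w))) σ-len)
  u≤n : length u ≤ n
  u≤n = subst (length u ≤_) uw-len
          (subst (length u ≤_) (sym (Listₚ.length-++ u)) (ℕₚ.m≤m+n (length u) (length w)))

insertions-injective : ∀ {n p p′ σ τ} →
  (p , σ) ∈ cartesianProduct (upTo (suc n)) (insertions n) →
  (p′ , τ) ∈ cartesianProduct (upTo (suc n)) (insertions n) →
  insertAt p n σ ≡ insertAt p′ n τ → (p , σ) ≡ (p′ , τ)
insertions-injective {n} {p} {p′} pσ∈ p′τ∈ eq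
  with p∈ , σ∈ ← ∈-cartesianProduct⁻ _ _ pσ∈
  with p′∈ , τ∈ ← ∈-cartesianProduct⁻ _ _ p′τ∈
  with isPermutation σ-len σ< _ ← ∈-insertions⁻ {n} σ∈
  with isPermutation τ-len τ< _ ← ∈-insertions⁻ {n} τ∈
  with refl , refl ← insertAt-injective (bounded⇒∉ σ<) (bounded⇒∉ τ<)
                       (subst (p ≤_) (sym σ-len) (ℕₚ.≤-pred (∈-upTo⁻ p∈)))
                       (subst (p′ ≤_) (sym τ-len) (ℕₚ.≤-pred (∈-upTo⁻ p′∈))) eq = refl

insertions-unique : ∀ n → Unique (insertions n)
insertions-unique zero    = [] ∷ []
insertions-unique (suc n) =
  Unique-map⁺-on insertions-injective
    (Uniqueₚ.cartesianProduct⁺ (Uniqueₚ.upTo⁺ (suc n)) (insertions-unique n))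

filterB≡filterᵇ : ∀ {A : Set} (p : A → Bool) xs → filterB p xs ≡ filterᵇ p xs
filterB≡filterᵇ p []       = refl
filterB≡filterᵇ p (x ∷ xs) with p x
... | true  = cong (x ∷_) (filterB≡filterᵇ p xs)
... | false = filterB≡filterᵇ p xs

concatMap-map≡cartesianProductWith : ∀ {A B C : Set} (f : A → B → C) xs ys →
  concatMap (λ x → map (f x) ys) xs ≡ cartesianProductWith f xs ys
concatMap-map≡cartesianProductWith f []       ys = refl
concatMap-map≡cartesianProductWith f (x ∷ xs) ys =
  cong (map (f x) ys ++_) (concatMap-map≡cartesianProductWith f xs ys)

seqs-suc : ∀ n m → seqs n (suc m) ≡ cartesianProductWith _∷_ (upTo n) (seqs n m)
seqs-suc n m = concatMap-map≡cartesianProductWith _∷_ (upTo n) (seqs n m)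

∈-seqs⁻ : ∀ {n} m {l} → l ∈ seqs n m → length l ≡ m × All (_< n) l
∈-seqs⁻ zero (here refl) = refl , []
∈-seqs⁻ {n} (suc m) {l} l∈
  with x , l′ , x∈ , l′∈ , refl ←
         ∈-cartesianProductWith⁻ _∷_ (upTo n) (seqs n m) (subst (l ∈_) (seqs-suc n m) l∈)
  with l′-len , l′< ← ∈-seqs⁻ m l′∈ = cong suc l′-len , ∈-upTo⁻ x∈ ∷ l′<

∈-seqs⁺ : ∀ {n} m {l} → length l ≡ m → All (_< n) l → l ∈ seqs n m
∈-seqs⁺ zero    {[]}    _     _          = here refl
∈-seqs⁺ {n} (suc m) {x ∷ l} l-len (x<n ∷ l<) =
  subst (x ∷ l ∈_) (sym (seqs-suc n m)) $
    ∈-cartesianProductWith⁺ _∷_ (∈-upTo⁺ x<n) (∈-seqs⁺ m (ℕₚ.suc-injective l-len) l<)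

seqs-unique : ∀ n m → Unique (seqs n m)
seqs-unique n zero    = [] ∷ []
seqs-unique n (suc m) = subst Unique (sym (seqs-suc n m)) $
  Uniqueₚ.cartesianProductWith⁺ _∷_ Listₚ.∷-injective (Uniqueₚ.upTo⁺ n) (seqs-unique n m)

All≢⇒¬any≡ᵇ : ∀ {x l} → All (x ≢_) l → T (not (any (x ≡ᵇ_) l))
All≢⇒¬any≡ᵇ [] = _
All≢⇒¬any≡ᵇ {x} {y ∷ l} (x≢y ∷ x≢l) with x ≡ᵇ y in eq
... | true  = contradiction (ℕₚ.≡ᵇ⇒≡ x y (subst T (sym eq) _)) x≢y
... | false = All≢⇒¬any≡ᵇ x≢l

¬any≡ᵇ⇒All≢ : ∀ {x} l → T (not (any (x ≡ᵇ_) l)) → All (x ≢_) l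
¬any≡ᵇ⇒All≢ []      _ = []
¬any≡ᵇ⇒All≢ {x} (y ∷ l) ¬any with x ≡ᵇ y in eq
... | false = (λ x≡y → subst T eq (ℕₚ.≡⇒≡ᵇ x y x≡y)) ∷ ¬any≡ᵇ⇒All≢ l ¬any

Unique⇒distinct : ∀ {l} → Unique l → T (distinct l)
Unique⇒distinct []          = _
Unique⇒distinct (x≢l ∷ l!) = T-∧ .Equivalence.from (All≢⇒¬any≡ᵇ x≢l , Unique⇒distinct l!)

distinct⇒Unique : ∀ l → T (distinct l) → Unique l
distinct⇒Unique []      _ = []
distinct⇒Unique (x ∷ l) d with ¬any , dl ← T-∧ .Equivalence.to d =
  ¬any≡ᵇ⇒All≢ l ¬any ∷ distinct⇒Unique l dl

∈-perms⁻ : ∀ {n σ} → σ ∈ perms n → IsPermutation n σ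
∈-perms⁻ {n} {σ} σ∈
  with σ∈seqs , d ←
         ∈-filter⁻ (T? ∘ distinct) (subst (σ ∈_) (filterB≡filterᵇ distinct (seqs n n)) σ∈)
  with σ-len , σ< ← ∈-seqs⁻ n σ∈seqs = isPermutation σ-len σ< (distinct⇒Unique σ d)

∈-perms⁺ : ∀ {n σ} → IsPermutation n σ → σ ∈ perms n
∈-perms⁺ {n} {σ} (isPermutation σ-len σ< σ!) =
  subst (σ ∈_) (sym (filterB≡filterᵇ distinct (seqs n n)))
    (∈-filter⁺ (T? ∘ distinct) (∈-seqs⁺ n σ-len σ<) (Unique⇒distinct σ!))

perms-unique : ∀ n → Unique (perms n)
perms-unique n rewrite filterB≡filterᵇ distinct (seqs n n) =
  Uniqueₚ.filter⁺ (T? ∘ distinct) (seqs-unique n n)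

perms↭insertions : ∀ n → perms n ↭ insertions n
perms↭insertions n = ∼bag⇒↭ $ unique∧set⇒bag (perms-unique n) (insertions-unique n) $
  mk⇔ (∈-insertions⁺ ∘ ∈-perms⁻ {n}) (∈-perms⁺ ∘ ∈-insertions⁻ {n})

map-<ᵇ-bounded : ∀ {x σ} → All (_< x) σ → map (_<ᵇ x) σ ≡ replicate (length σ) true
map-<ᵇ-bounded []           = refl
map-<ᵇ-bounded (y<x ∷ σ<x) = cong₂ _∷_ (<⇒<ᵇ≡true y<x) (map-<ᵇ-bounded σ<x)

All-<-suc-sum : ∀ u → All (_< suc (sum u)) u
All-<-suc-sum []      = []
All-<-suc-sum (x ∷ u) = s≤s (ℕₚ.m≤m+n x (sum u))
                      ∷ All.map (λ y<1+Σu → ℕₚ.≤-trans y<1+Σu (s≤s (ℕₚ.m≤n+m (sum u) x)))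
                                (All-<-suc-sum u)

-- Records, for each entry, which later entries are smaller; for lists without repetitions this is
-- their relative order.
data SamePattern : List ℕ → List ℕ → Set where
  []  : SamePattern [] []
  _∷_ : ∀ {x y u v} → map (_<ᵇ x) u ≡ map (_<ᵇ y) v → SamePattern u v → SamePattern (x ∷ u) (y ∷ v)

SamePattern-refl : ∀ u → SamePattern u u
SamePattern-refl []      = []
SamePattern-refl (x ∷ u) = refl ∷ SamePattern-refl u

SamePattern⇒length≡ : ∀ {u v} → SamePattern u v → length u ≡ length v
SamePattern⇒length≡ []      = refl
SamePattern⇒length≡ (_ ∷ s) = cong suc (SamePattern⇒length≡ s)

SamePattern-insertAt : ∀ p {x y u v} → All (_< x) u → All (_< y) v → SamePattern u v →
                       SamePattern (insertAt p x u) (insertAt p y v)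
SamePattern-insertAt zero    u<x v<y s =
  trans (map-<ᵇ-bounded u<x) (trans (cong (λ n → replicate n true) (SamePattern⇒length≡ s))
                                     (sym (map-<ᵇ-bounded v<y)))
  ∷ s
SamePattern-insertAt (suc p) []        []        []      = refl ∷ []
SamePattern-insertAt (suc p) {x} {y} {a ∷ u} {b ∷ v} (a<x ∷ u<x) (b<y ∷ v<y) (e ∷ s) =
  (begin
    map (_<ᵇ a) (insertAt p x u)       ≡⟨ map-insertAt (_<ᵇ a) p x u ⟩
    insertAt p (x <ᵇ a) (map (_<ᵇ a) u) ≡⟨ cong₂ (insertAt p) x<ᵇa≡y<ᵇb e ⟩
    insertAt p (y <ᵇ b) (map (_<ᵇ b) v) ≡⟨ map-insertAt (_<ᵇ b) p y v ⟨
    map (_<ᵇ b) (insertAt p y v)       ∎)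
  ∷ SamePattern-insertAt p u<x v<y s
  where
  open ≡-Reasoning
  x<ᵇa≡y<ᵇb = trans (>⇒<ᵇ≡false a<x) (sym (>⇒<ᵇ≡false b<y))

descOK-SamePattern : ∀ k i {u v} → SamePattern u v → descOK k i u ≡ descOK k i v
descOK-SamePattern k i []                         = refl
descOK-SamePattern k i (_ ∷ [])                   = refl
descOK-SamePattern k i {x ∷ a ∷ u} {y ∷ b ∷ v} (e ∷ s) =
  cong₂ (λ c d → boolEq c ⌊ k ∣? i ⌋ ∧ d) (Listₚ.∷-injectiveˡ e) (descOK-SamePattern k (suc i) s)

-- Inversions and descents after inserting the maximum

countB-insertAt-false : ∀ {A : Set} (p : A → Bool) i {x} σ → p x ≡ false →
                        countB p (insertAt i x σ) ≡ countB p σ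
countB-insertAt-false p zero    σ       px≡false rewrite px≡false = refl
countB-insertAt-false p (suc i) []      px≡false rewrite px≡false = refl
countB-insertAt-false p (suc i) (y ∷ σ) px≡false =
  cong (_ +ℕ_) (countB-insertAt-false p i σ px≡false)

countB-all : ∀ {A : Set} (p : A → Bool) {σ} → All (λ y → p y ≡ true) σ → countB p σ ≡ length σ
countB-all p []              = refl
countB-all p (py ∷ pσ) rewrite py = cong suc (countB-all p pσ)

inv-insertAt-max : ∀ p {x} σ → All (_< x) σ → inv (insertAt p x σ) ≡ inv σ +ℕ (length σ ∸ p)
inv-insertAt-max zero    σ σ<x =
  trans (cong (_+ℕ inv σ) (countB-all _ (All.map <⇒<ᵇ≡true σ<x))) (ℕₚ.+-comm (length σ) (inv σ))
inv-insertAt-max (suc p) []      _ = refl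
inv-insertAt-max (suc p) {x} (y ∷ σ) (y<x ∷ σ<x) = begin
  countB (_<ᵇ y) (insertAt p x σ) +ℕ inv (insertAt p x σ)
    ≡⟨ cong₂ _+ℕ_ (countB-insertAt-false (_<ᵇ y) p σ (>⇒<ᵇ≡false y<x)) (inv-insertAt-max p σ σ<x) ⟩
  countB (_<ᵇ y) σ +ℕ (inv σ +ℕ (length σ ∸ p))
    ≡⟨ ℕₚ.+-assoc (countB (_<ᵇ y) σ) (inv σ) _ ⟨
  countB (_<ᵇ y) σ +ℕ inv σ +ℕ (length σ ∸ p) ∎
  where open ≡-Reasoning

descOK-insertAt : ∀ k i p x σ →
  descOK k i (insertAt p x σ) ≡ descOK k i (take p σ ∷ʳ x) ∧ descOK k (p +ℕ i) (x ∷ drop p σ)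
descOK-insertAt k i zero          x σ           = refl
descOK-insertAt k i (suc p)       x []          = sym (∧-identityʳ _)
descOK-insertAt k i (suc zero)    x (y ∷ σ)     = cong (_∧ descOK k (suc i) (x ∷ σ)) (sym (∧-identityʳ _))
descOK-insertAt k i (suc (suc p)) x (y ∷ [])    = sym (∧-identityʳ _)
descOK-insertAt k i (suc (suc p)) x (y ∷ z ∷ σ) = begin
  c ∧ descOK k (suc i) (insertAt (suc p) x (z ∷ σ))
    ≡⟨ cong (c ∧_) (descOK-insertAt k (suc i) (suc p) x (z ∷ σ)) ⟩
  c ∧ (descOK k (suc i) (z ∷ take p σ ∷ʳ x) ∧ descOK k (suc p +ℕ suc i) (x ∷ drop p σ))
    ≡⟨ ∧-assoc c _ _ ⟨
  (c ∧ descOK k (suc i) (z ∷ take p σ ∷ʳ x)) ∧ descOK k (suc p +ℕ suc i) (x ∷ drop p σ)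
    ≡⟨ cong (λ j → (c ∧ descOK k (suc i) (z ∷ take p σ ∷ʳ x)) ∧ descOK k j (x ∷ drop p σ))
            (ℕₚ.+-suc (suc p) i) ⟩
  (c ∧ descOK k (suc i) (z ∷ take p σ ∷ʳ x)) ∧ descOK k (suc (suc p) +ℕ i) (x ∷ drop p σ) ∎
  where
  open ≡-Reasoning
  c = boolEq (z <ᵇ y) ⌊ k ∣? i ⌋

descOK-∷ʳ-max : ∀ k i {x} y u → All (_< x) (y ∷ u) →
  descOK k i (y ∷ u ∷ʳ x) ≡ descOK k i (y ∷ u) ∧ not ⌊ k ∣? length u +ℕ i ⌋
descOK-∷ʳ-max k i {x} y []      (y<x ∷ []) rewrite >⇒<ᵇ≡false {x} y<x = ∧-identityʳ _
descOK-∷ʳ-max k i {x} y (z ∷ u) (_ ∷ z<x ∷ u<x) = begin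
  c ∧ descOK k (suc i) (z ∷ u ∷ʳ x)
    ≡⟨ cong (c ∧_) (descOK-∷ʳ-max k (suc i) z u (z<x ∷ u<x)) ⟩
  c ∧ (descOK k (suc i) (z ∷ u) ∧ not ⌊ k ∣? length u +ℕ suc i ⌋)
    ≡⟨ ∧-assoc c _ _ ⟨
  (c ∧ descOK k (suc i) (z ∷ u)) ∧ not ⌊ k ∣? length u +ℕ suc i ⌋
    ≡⟨ cong (λ j → (c ∧ descOK k (suc i) (z ∷ u)) ∧ not ⌊ k ∣? j ⌋) (ℕₚ.+-suc (length u) i) ⟩
  (c ∧ descOK k (suc i) (z ∷ u)) ∧ not ⌊ k ∣? suc (length u) +ℕ i ⌋ ∎
  where
  open ≡-Reasoning
  c = boolEq (z <ᵇ y) ⌊ k ∣? i ⌋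

descOK-max-drop : ∀ k j p {x} σ → All (_< x) σ → p < length σ →
  descOK k j (x ∷ drop p σ) ≡ ⌊ k ∣? j ⌋ ∧ descOK k (suc j) (drop p σ)
descOK-max-drop k j zero    {x} (y ∷ σ) (y<x ∷ _) _ rewrite <⇒<ᵇ≡true y<x = refl
descOK-max-drop k j (suc p)     (y ∷ σ) (_ ∷ σ<x) (s≤s p<σ) = descOK-max-drop k j p σ σ<x p<σ

descOK-insertAt-inner : ∀ {k} → 2 ≤ k → ∀ p {x} σ → All (_< x) σ → p < length σ →
  descOK k 1 (insertAt p x σ)
    ≡ ⌊ k ∣? p +ℕ 1 ⌋ ∧ (descOK k 1 (take p σ) ∧ descOK k (suc (p +ℕ 1)) (drop p σ))
descOK-insertAt-inner {k} 2≤k zero    σ σ<x p<σ = descOK-max-drop k 1 0 σ σ<x p<σ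
descOK-insertAt-inner {k} 2≤k (suc p) {x} (y ∷ σ) (y<x ∷ σ<x) (s≤s p<σ) = begin
  descOK k 1 (insertAt (suc p) x (y ∷ σ))
    ≡⟨ descOK-insertAt k 1 (suc p) x (y ∷ σ) ⟩
  descOK k 1 (y ∷ take p σ ∷ʳ x) ∧ descOK k (suc p +ℕ 1) (x ∷ drop p σ)
    ≡⟨ cong₂ _∧_ (descOK-∷ʳ-max k 1 y (take p σ) (y<x ∷ take⁺ p σ<x))
                 (descOK-max-drop k (suc p +ℕ 1) p σ σ<x p<σ) ⟩
  (A ∧ not ⌊ k ∣? length (take p σ) +ℕ 1 ⌋) ∧ (⌊ k ∣? suc p +ℕ 1 ⌋ ∧ D)
    ≡⟨ cong (λ j → (A ∧ not ⌊ k ∣? j +ℕ 1 ⌋) ∧ (⌊ k ∣? suc p +ℕ 1 ⌋ ∧ D))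
            (trans (Listₚ.length-take p σ) (ℕₚ.m≤n⇒m⊓n≡m (ℕₚ.<⇒≤ p<σ))) ⟩
  (A ∧ not ⌊ k ∣? p +ℕ 1 ⌋) ∧ (⌊ k ∣? suc p +ℕ 1 ⌋ ∧ D)
    -- the ascent left of x is implied by the descent right of it, as k ≥ 2
    ≡⟨ reassociate A _ _ D (∣?-suc 2≤k (p +ℕ 1)) ⟩
  ⌊ k ∣? suc p +ℕ 1 ⌋ ∧ (A ∧ D) ∎
  where
  open ≡-Reasoning
  A = descOK k 1 (y ∷ take p σ)
  D = descOK k (suc (suc p +ℕ 1)) (drop p σ)
  reassociate : ∀ a n c d → c ∧ n ≡ c → (a ∧ n) ∧ (c ∧ d) ≡ c ∧ (a ∧ d)
  reassociate a n false d _    = ∧-zeroʳ (a ∧ n)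
  reassociate a n true  d refl = cong (_∧ d) (∧-identityʳ a)

descOK-insertAt-last : ∀ k {x} σ → All (_< x) σ → 1 ≤ length σ →
  descOK k 1 (insertAt (length σ) x σ) ≡ not ⌊ k ∣? length σ ⌋ ∧ descOK k 1 σ
descOK-insertAt-last k {x} (y ∷ u) σ<x _ = begin
  descOK k 1 (insertAt (length (y ∷ u)) x (y ∷ u)) ≡⟨ cong (descOK k 1) (insertAt-length x (y ∷ u)) ⟩
  descOK k 1 (y ∷ u ∷ʳ x)                          ≡⟨ descOK-∷ʳ-max k 1 y u σ<x ⟩
  descOK k 1 (y ∷ u) ∧ not ⌊ k ∣? length u +ℕ 1 ⌋   ≡⟨ ∧-comm (descOK k 1 (y ∷ u)) _ ⟩
  not ⌊ k ∣? length u +ℕ 1 ⌋ ∧ descOK k 1 (y ∷ u)   ≡⟨ cong (λ j → not ⌊ k ∣? j ⌋ ∧ descOK k 1 (y ∷ u))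
                                                           (ℕₚ.+-comm (length u) 1) ⟩
  not ⌊ k ∣? suc (length u) ⌋ ∧ descOK k 1 (y ∷ u) ∎
  where open ≡-Reasoning

descOK-periodic : ∀ k c i l → k ∣ c → descOK k (c +ℕ i) l ≡ descOK k i l
descOK-periodic k c i []          _   = refl
descOK-periodic k c i (_ ∷ [])    _   = refl
descOK-periodic k c i (a ∷ b ∷ l) k∣c = cong₂ (λ d r → boolEq (b <ᵇ a) d ∧ r)
  (∣?-periodic i k∣c)
  (trans (cong (λ j → descOK k j (b ∷ l)) (sym (ℕₚ.+-suc c i)))
         (descOK-periodic k c (suc i) (b ∷ l) k∣c))

module _ (R : CommutativeSemiring 0ℓ 0ℓ) where
  open CommutativeSemiring R
    hiding (zero) renaming (refl to ≈-refl; sym to ≈-sym; trans to ≈-trans; reflexive to ≈-reflexive)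
  open import Relation.Binary.Reasoning.Setoid setoid

  ∑ : {A : Set} → List A → (A → Carrier) → Carrier
  ∑ xs f = sumR R (map f xs)

  ∑-++ : ∀ {A : Set} (xs ys : List A) f → ∑ (xs ++ ys) f ≈ ∑ xs f + ∑ ys f
  ∑-++ []       ys f = ≈-sym (+-identityˡ _)
  ∑-++ (x ∷ xs) ys f = ≈-trans (+-congˡ (∑-++ xs ys f)) (≈-sym (+-assoc _ _ _))

  ∑-cong : ∀ {A : Set} (xs : List A) {f g} → (∀ {x} → x ∈ xs → f x ≈ g x) → ∑ xs f ≈ ∑ xs g
  ∑-cong []       _   = ≈-refl
  ∑-cong (x ∷ xs) f≈g = +-cong (f≈g (here refl)) (∑-cong xs (f≈g ∘ there))

  ∑-map : ∀ {A B : Set} (g : A → B) xs f → ∑ (map g xs) f ≡ ∑ xs (f ∘ g)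
  ∑-map g xs f = cong (sumR R) (sym (Listₚ.map-∘ xs))

  ∑-*ˡ : ∀ {A : Set} c (xs : List A) f → c * ∑ xs f ≈ ∑ xs (λ x → c * f x)
  ∑-*ˡ c []       f = zeroʳ c
  ∑-*ˡ c (x ∷ xs) f = ≈-trans (distribˡ c (f x) (∑ xs f)) (+-congˡ (∑-*ˡ c xs f))

  ∑-cartesianProduct : ∀ {A B : Set} (xs : List A) (ys : List B) f →
    ∑ (cartesianProduct xs ys) f ≈ ∑ xs (λ x → ∑ ys (λ y → f (x , y)))
  ∑-cartesianProduct []       ys f = ≈-refl
  ∑-cartesianProduct (x ∷ xs) ys f = begin
    ∑ (map (x ,_) ys ++ cartesianProduct xs ys) f          ≈⟨ ∑-++ (map (x ,_) ys) _ f ⟩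
    ∑ (map (x ,_) ys) f + ∑ (cartesianProduct xs ys) f     ≈⟨ +-cong (≈-reflexive (∑-map (x ,_) ys f))
                                                                     (∑-cartesianProduct xs ys f) ⟩
    ∑ ys (λ y → f (x , y)) + ∑ xs (λ x → ∑ ys (λ y → f (x , y))) ∎

  ∑-↭ : ∀ {A : Set} {xs ys : List A} f → xs ↭ ys → ∑ xs f ≈ ∑ ys f
  ∑-↭ f xs↭ys =
    foldr-commMonoid setoid +-isCommutativeMonoid (↭⇒↭ₛ′ isEquivalence (↭-map⁺ f xs↭ys))

  ∑-filterB : ∀ {A : Set} (p : A → Bool) xs f → ∑ (filterB p xs) f ≈ ∑ xs (λ x → chiB R (p x) * f x)
  ∑-filterB p []       f = ≈-refl
  ∑-filterB p (x ∷ xs) f with p x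
  ... | true  = +-cong (≈-sym (*-identityˡ (f x))) (∑-filterB p xs f)
  ... | false =
    ≈-trans (∑-filterB p xs f) (≈-trans (≈-sym (+-identityˡ _)) (+-congʳ (≈-sym (zeroˡ (f x)))))

  ∑-upTo-suc : ∀ n f → ∑ (upTo (suc n)) f ≈ ∑ (upTo n) f + f n
  ∑-upTo-suc n f = begin
    ∑ (upTo (suc n)) f     ≡⟨ cong (λ xs → ∑ xs f) (Listₚ.upTo-∷ʳ n) ⟨
    ∑ (upTo n ∷ʳ n) f      ≈⟨ ∑-++ (upTo n) [ n ] f ⟩
    ∑ (upTo n) f + (f n + 0#) ≈⟨ +-congˡ (+-identityʳ (f n)) ⟩
    ∑ (upTo n) f + f n     ∎

  ∑-upTo-+ : ∀ m n f → ∑ (upTo (m +ℕ n)) f ≈ ∑ (upTo m) f + ∑ (upTo n) (λ j → f (m +ℕ j))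
  ∑-upTo-+ m zero    f = begin
    ∑ (upTo (m +ℕ 0)) f ≡⟨ cong (λ i → ∑ (upTo i) f) (ℕₚ.+-identityʳ m) ⟩
    ∑ (upTo m) f        ≈⟨ +-identityʳ _ ⟨
    ∑ (upTo m) f + 0#   ∎
  ∑-upTo-+ m (suc n) f = begin
    ∑ (upTo (m +ℕ suc n)) f              ≡⟨ cong (λ i → ∑ (upTo i) f) (ℕₚ.+-suc m n) ⟩
    ∑ (upTo (suc (m +ℕ n))) f            ≈⟨ ∑-upTo-suc (m +ℕ n) f ⟩
    ∑ (upTo (m +ℕ n)) f + g n            ≈⟨ +-congʳ (∑-upTo-+ m n f) ⟩
    ∑ (upTo m) f + ∑ (upTo n) g + g n    ≈⟨ +-assoc _ _ _ ⟩
    ∑ (upTo m) f + (∑ (upTo n) g + g n)  ≈⟨ +-congˡ (∑-upTo-suc n g) ⟨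
    ∑ (upTo m) f + ∑ (upTo (suc n)) g    ∎
    where
    g : ℕ → Carrier
    g j = f (m +ℕ j)

  ∑-insertions-suc : ∀ n F →
    ∑ (insertions (suc n)) F ≈ ∑ (upTo (suc n)) (λ p → ∑ (insertions n) (F ∘ insertAt p n))
  ∑-insertions-suc n F =
    ≈-trans (≈-reflexive (∑-map _ (cartesianProduct (upTo (suc n)) (insertions n)) F))
            (∑-cartesianProduct (upTo (suc n)) (insertions n) _)

  ∑-insertions-split : ∀ {M} a b → a +ℕ b ≡ suc M → ∀ F →
    ∑ (insertions (suc M)) F ≈ ∑ (upTo a) (λ p → ∑ (insertions M) (F ∘ insertAt p M))
                             + ∑ (upTo b) (λ j → ∑ (insertions M) (F ∘ insertAt (a +ℕ j) M))
  ∑-insertions-split {M} a b a+b≡1+M F = begin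
    ∑ (insertions (suc M)) F    ≈⟨ ∑-insertions-suc M F ⟩
    ∑ (upTo (suc M)) H          ≡⟨ cong (λ n → ∑ (upTo n) H) a+b≡1+M ⟨
    ∑ (upTo (a +ℕ b)) H         ≈⟨ ∑-upTo-+ a b H ⟩
    ∑ (upTo a) H + ∑ (upTo b) (λ j → H (a +ℕ j)) ∎
    where
    H : ℕ → Carrier
    H p = ∑ (insertions M) (F ∘ insertAt p M)

  ∑-multiples : ∀ k .{{_ : NonZero k}} n (f : ℕ → Carrier) →
    ∑ (upTo n) (λ p → chiB R ⌊ k ∣? p +ℕ 1 ⌋ * f p) ≈ ∑ (map suc (upTo (n / k))) (λ m → f (m *ℕ k ∸ 1))
  ∑-multiples k zero    f =
    ≈-reflexive (cong (λ i → ∑ (map suc (upTo i)) (λ m → f (m *ℕ k ∸ 1))) (sym (0/n≡0 k)))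
  ∑-multiples k (suc n) f = begin
    ∑ (upTo (suc n)) h                        ≈⟨ ∑-upTo-suc n h ⟩
    ∑ (upTo n) h + h n                        ≈⟨ +-congʳ (∑-multiples k n f) ⟩
    ∑ (map suc (upTo (n / k))) g + h n        ≈⟨ add-last ⟩
    ∑ (map suc (upTo (suc n / k))) g          ∎
    where
    h : ℕ → Carrier
    h p = chiB R ⌊ k ∣? p +ℕ 1 ⌋ * f p
    g : ℕ → Carrier
    g m = f (m *ℕ k ∸ 1)
    add-last : ∑ (map suc (upTo (n / k))) g + h n ≈ ∑ (map suc (upTo (suc n / k))) g
    add-last with k ∣? n +ℕ 1
    ... | no k∤n+1 = begin
      ∑ (map suc (upTo (n / k))) g + 0# * f n   ≈⟨ +-congˡ (zeroˡ (f n)) ⟩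
      ∑ (map suc (upTo (n / k))) g + 0#         ≈⟨ +-identityʳ _ ⟩
      ∑ (map suc (upTo (n / k))) g              ≡⟨ cong (λ i → ∑ (map suc (upTo i)) g) (suc-/-∤ k∤1+n) ⟨
      ∑ (map suc (upTo (suc n / k))) g          ∎
      where k∤1+n = k∤n+1 ∘ subst (k ∣_) (ℕₚ.+-comm 1 n)
    ... | yes k∣n+1 = begin
      ∑ (map suc (upTo (n / k))) g + 1# * f n   ≈⟨ +-congˡ (*-identityˡ (f n)) ⟩
      ∑ (map suc (upTo (n / k))) g + f n        ≡⟨ cong₂ (λ s i → s + f i) (∑-map suc (upTo (n / k)) g) n≡ ⟩
      ∑ (upTo (n / k)) (g ∘ suc) + g (suc (n / k)) ≈⟨ ∑-upTo-suc (n / k) (g ∘ suc) ⟨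
      ∑ (upTo (suc (n / k))) (g ∘ suc)          ≡⟨ ∑-map suc (upTo (suc (n / k))) g ⟨
      ∑ (map suc (upTo (suc (n / k)))) g        ≡⟨ cong (λ i → ∑ (map suc (upTo i)) g) (suc-/-∣ k∣1+n) ⟨
      ∑ (map suc (upTo (suc n / k))) g          ∎
      where
      k∣1+n = subst (k ∣_) (ℕₚ.+-comm n 1) k∣n+1
      n≡ : n ≡ suc (n / k) *ℕ k ∸ 1
      n≡ = cong (_∸ 1) (trans (sym (m/n*n≡m k∣1+n)) (cong (_*ℕ k) (suc-/-∣ k∣1+n)))

  chiB-∧ : ∀ a b → chiB R (a ∧ b) ≈ chiB R a * chiB R b
  chiB-∧ true  b = ≈-sym (*-identityˡ _)
  chiB-∧ false b = ≈-sym (zeroˡ _)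

  module _ (q : Carrier) where
    open import Algebra.Solver.Ring.NaturalCoefficients.Default R using (solve; _:=_; _:+_; _:*_; con)

    private
      q^_ : ℕ → Carrier
      q^_ = pow R q
      infix 8 q^_

    pow-+ : ∀ m n → q^ (m +ℕ n) ≈ q^ m * q^ n
    pow-+ zero    n = ≈-sym (*-identityˡ _)
    pow-+ (suc m) n = ≈-trans (*-congˡ (pow-+ m n)) (≈-sym (*-assoc _ _ _))

    gauss-zero : ∀ n → gauss R q n 0 ≡ 1#
    gauss-zero zero    = refl
    gauss-zero (suc n) = refl

    gauss-big : ∀ {n j} → n < j → gauss R q n j ≈ 0#
    gauss-big {zero}  {suc j} _         = ≈-refl
    gauss-big {suc n} {suc j} (s≤s n<j) = begin
      gauss R q n j + q^ suc j * gauss R q n (suc j)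
        ≈⟨ +-cong (gauss-big n<j) (*-congˡ (gauss-big (ℕₚ.m<n⇒m<1+n n<j))) ⟩
      0# + q^ suc j * 0#  ≈⟨ +-identityˡ _ ⟩
      q^ suc j * 0#       ≈⟨ zeroʳ _ ⟩
      0#                  ∎

    gauss-suc-suc′ : ∀ n j → j ≤ n →
      gauss R q (suc n) (suc j) ≈ q^ (n ∸ j) * gauss R q n j + gauss R q n (suc j)
    gauss-suc-suc′ n j j≤n with ℕₚ.m≤n⇒m<n∨m≡n j≤n
    ... | inj₂ refl = begin
      gauss R q n n + q^ suc n * gauss R q n (suc n)
        ≈⟨ +-cong (≈-sym (*-identityˡ _)) (≈-trans (*-congˡ Gn[1+n]≈0) (≈-trans (zeroʳ _) (≈-sym Gn[1+n]≈0))) ⟩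
      q^ 0 * gauss R q n n + gauss R q n (suc n)
        ≡⟨ cong (λ e → q^ e * gauss R q n n + gauss R q n (suc n)) (ℕₚ.n∸n≡0 n) ⟨
      q^ (n ∸ n) * gauss R q n n + gauss R q n (suc n) ∎
      where Gn[1+n]≈0 = gauss-big {n} ℕₚ.≤-refl
    gauss-suc-suc′ (suc n) zero    _ | inj₁ _ = begin
      1# + q^ 1 * gauss R q (suc n) 1
        ≈⟨ +-congˡ (*-congˡ (gauss-suc-suc′ n 0 z≤n)) ⟩
      1# + q^ 1 * (q^ n * gauss R q n 0 + gauss R q n 1)
        ≡⟨ cong (λ g → 1# + q^ 1 * (q^ n * g + gauss R q n 1)) (gauss-zero n) ⟩
      1# + q^ 1 * (q^ n * 1# + gauss R q n 1)
        ≈⟨ solve 3 (λ x y z → con 1 :+ (x :* con 1) :* (y :* con 1 :+ z)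
                           := x :* y :* con 1 :+ (con 1 :+ (x :* con 1) :* z))
                   ≈-refl q (q^ n) (gauss R q n 1) ⟩
      q^ suc n * 1# + (1# + q^ 1 * gauss R q n 1)
        ≡⟨ cong (λ g → q^ suc n * 1# + (g + q^ 1 * gauss R q n 1)) (gauss-zero n) ⟨
      q^ suc n * 1# + gauss R q (suc n) 1 ∎
    gauss-suc-suc′ (suc n) (suc j) _ | inj₁ (s≤s j<n) = begin
      gauss R q (suc n) (suc j) + q^ (2 +ℕ j) * gauss R q (suc n) (2 +ℕ j)
        ≈⟨ +-cong (gauss-suc-suc′ n j (ℕₚ.<⇒≤ j<n)) (*-congˡ (gauss-suc-suc′ n (suc j) j<n)) ⟩
      (q^ (n ∸ j) * A + B) + q^ (2 +ℕ j) * (q^ e * B + C)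
        ≡⟨ cong (λ i → (q^ i * A + B) + q^ (2 +ℕ j) * (q^ e * B + C)) n∸j≡ ⟩
      (q * q^ e * A + B) + q * (q * q^ j) * (q^ e * B + C)
        ≈⟨ solve 6 (λ Q E J A B C → (Q :* E :* A :+ B) :+ Q :* (Q :* J) :* (E :* B :+ C)
                                  := Q :* E :* (A :+ Q :* J :* B) :+ (B :+ Q :* (Q :* J) :* C))
                   ≈-refl q (q^ e) (q^ j) A B C ⟩
      q * q^ e * (A + q^ suc j * B) + (B + q^ (2 +ℕ j) * C)
        ≡⟨ cong (λ i → q^ i * (A + q^ suc j * B) + (B + q^ (2 +ℕ j) * C)) n∸j≡ ⟨
      q^ (n ∸ j) * (A + q^ suc j * B) + (B + q^ (2 +ℕ j) * C) ∎
      where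
      A = gauss R q n j
      B = gauss R q n (suc j)
      C = gauss R q n (2 +ℕ j)
      e = n ∸ suc j
      n∸j≡ : n ∸ j ≡ suc e
      n∸j≡ = ℕₚ.+-∸-assoc 1 j<n

    -- Order-invariant weights and the q-binomial shuffle identity

    pow-inv-insertAt-max : ∀ p {n σ} → IsPermutation n σ →
                           q^ inv (insertAt p n σ) ≈ q^ (n ∸ p) * q^ inv σ
    pow-inv-insertAt-max p {σ = σ} (isPermutation refl σ< _) = begin
      q^ inv (insertAt p (length σ) σ)  ≡⟨ cong q^_ (inv-insertAt-max p σ σ<) ⟩
      q^ (inv σ +ℕ (length σ ∸ p))      ≡⟨ cong q^_ (ℕₚ.+-comm (inv σ) _) ⟩
      q^ (length σ ∸ p +ℕ inv σ)        ≈⟨ pow-+ (length σ ∸ p) (inv σ) ⟩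
      q^ (length σ ∸ p) * q^ inv σ      ∎

    OrderInvariant : (List ℕ → Carrier) → Set
    OrderInvariant f = ∀ {u v} → SamePattern u v → f u ≈ f v

    -- suc (sum u) is just some value above all entries of u; for order-invariant f any such value
    -- gives the same result (withMaxAt-insertAt).
    withMaxAt : ℕ → (List ℕ → Carrier) → List ℕ → Carrier
    withMaxAt p f u = f (insertAt p (suc (sum u)) u)

    withMaxAt-invariant : ∀ p {f} → OrderInvariant f → OrderInvariant (withMaxAt p f)
    withMaxAt-invariant p f-inv {u} {v} s =
      f-inv (SamePattern-insertAt p (All-<-suc-sum u) (All-<-suc-sum v) s)

    withMaxAt-insertAt : ∀ p {f} → OrderInvariant f → ∀ {x} u → All (_< x) u →
                         f (insertAt p x u) ≈ withMaxAt p f u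
    withMaxAt-insertAt p f-inv u u<x =
      f-inv (SamePattern-insertAt p u<x (All-<-suc-sum u) (SamePattern-refl u))

    invGF : (List ℕ → Carrier) → ℕ → Carrier
    invGF f n = ∑ (insertions n) (λ σ → f σ * q^ inv σ)

    invGF-cong : ∀ {f g} → (∀ σ → f σ ≈ g σ) → ∀ n → invGF f n ≈ invGF g n
    invGF-cong f≈g n = ∑-cong (insertions n) (λ {σ} _ → *-congʳ (f≈g σ))

    invGF-suc : ∀ {f} → OrderInvariant f → ∀ n →
      invGF f (suc n) ≈ ∑ (upTo (suc n)) (λ p → q^ (n ∸ p) * invGF (withMaxAt p f) n)
    invGF-suc {f} f-inv n =
      ≈-trans (∑-insertions-suc n _) $ ∑-cong (upTo (suc n)) λ {p} _ →
        ≈-trans (∑-cong (insertions n) (term p)) (≈-sym (∑-*ˡ _ (insertions n) _))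
      where
      term : ∀ p {σ} → σ ∈ insertions n →
        f (insertAt p n σ) * q^ inv (insertAt p n σ) ≈ q^ (n ∸ p) * (withMaxAt p f σ * q^ inv σ)
      term p {σ} σ∈ = begin
        f (insertAt p n σ) * q^ inv (insertAt p n σ)
          ≈⟨ *-cong (withMaxAt-insertAt p f-inv σ (IsPermutation.bounded σ-perm))
                    (pow-inv-insertAt-max p σ-perm) ⟩
        withMaxAt p f σ * (q^ (n ∸ p) * q^ inv σ)
          ≈⟨ solve 3 (λ W P I → W :* (P :* I) := P :* (W :* I)) ≈-refl _ _ _ ⟩
        q^ (n ∸ p) * (withMaxAt p f σ * q^ inv σ) ∎
        where σ-perm = ∈-insertions⁻ σ∈

    splitWeight : ℕ → (List ℕ → Carrier) → (List ℕ → Carrier) → List ℕ → Carrier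
    splitWeight a f g σ = f (take a σ) * g (drop a σ) * q^ inv σ

    ShuffleIdentity : ℕ → Set
    ShuffleIdentity N = ∀ a b → a +ℕ b ≡ N → ∀ {f g} → OrderInvariant f → OrderInvariant g →
                        ∑ (insertions N) (splitWeight a f g) ≈ gauss R q N a * (invGF f a * invGF g b)

    shuffle-left : ∀ {M a b f g} → ShuffleIdentity M → a +ℕ b ≡ M →
      OrderInvariant f → OrderInvariant g →
      ∑ (upTo (suc a)) (λ p → ∑ (insertions M) (splitWeight (suc a) f g ∘ insertAt p M))
        ≈ q^ b * gauss R q M a * (invGF f (suc a) * invGF g b)
    shuffle-left {M} {a} {b} {f} {g} shuffle-M a+b≡M f-inv g-inv = begin
      ∑ (upTo (suc a)) (λ p → ∑ (insertions M) (splitWeight (suc a) f g ∘ insertAt p M))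
        ≈⟨ ∑-cong (upTo (suc a)) (λ p∈ → insert-left _ (ℕₚ.≤-pred (∈-upTo⁻ p∈))) ⟩
      ∑ (upTo (suc a)) (λ p → K * (q^ (a ∸ p) * invGF (withMaxAt p f) a))
        ≈⟨ ∑-*ˡ K (upTo (suc a)) _ ⟨
      K * ∑ (upTo (suc a)) (λ p → q^ (a ∸ p) * invGF (withMaxAt p f) a)
        ≈⟨ *-congˡ (invGF-suc f-inv a) ⟨
      K * invGF f (suc a)
        ≈⟨ solve 4 (λ Q G I F → Q :* G :* I :* F := Q :* G :* (F :* I)) ≈-refl _ _ _ _ ⟩
      q^ b * gauss R q M a * (invGF f (suc a) * invGF g b) ∎
      where
      K = q^ b * gauss R q M a * invGF g b
      term : ∀ p → p ≤ a → ∀ {σ} → σ ∈ insertions M →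
             splitWeight (suc a) f g (insertAt p M σ) ≈ q^ (M ∸ p) * splitWeight a (withMaxAt p f) g σ
      term p p≤a {σ} σ∈ = begin
        f (take (suc a) (insertAt p M σ)) * g (drop (suc a) (insertAt p M σ)) * q^ inv (insertAt p M σ)
          ≡⟨ cong₂ (λ t d → f t * g d * q^ inv (insertAt p M σ))
                   (take-insertAt-≤ M σ p≤a) (drop-insertAt-≤ M σ p≤a) ⟩
        f (insertAt p M (take a σ)) * g (drop a σ) * q^ inv (insertAt p M σ)
          ≈⟨ *-cong (*-congʳ (withMaxAt-insertAt p f-inv (take a σ) (take⁺ a (IsPermutation.bounded σ-perm))))
                    (pow-inv-insertAt-max p σ-perm) ⟩
        withMaxAt p f (take a σ) * g (drop a σ) * (q^ (M ∸ p) * q^ inv σ)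
          ≈⟨ solve 4 (λ F G P I → F :* G :* (P :* I) := P :* (F :* G :* I)) ≈-refl _ _ _ _ ⟩
        q^ (M ∸ p) * splitWeight a (withMaxAt p f) g σ ∎
        where σ-perm = ∈-insertions⁻ σ∈
      insert-left : ∀ p → p ≤ a →
        ∑ (insertions M) (splitWeight (suc a) f g ∘ insertAt p M) ≈ K * (q^ (a ∸ p) * invGF (withMaxAt p f) a)
      insert-left p p≤a = begin
        ∑ (insertions M) (splitWeight (suc a) f g ∘ insertAt p M)
          ≈⟨ ∑-cong (insertions M) (term p p≤a) ⟩
        ∑ (insertions M) (λ σ → q^ (M ∸ p) * splitWeight a (withMaxAt p f) g σ)
          ≈⟨ ∑-*ˡ _ (insertions M) _ ⟨
        q^ (M ∸ p) * ∑ (insertions M) (splitWeight a (withMaxAt p f) g)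
          ≈⟨ *-congˡ (shuffle-M a b a+b≡M (withMaxAt-invariant p f-inv) g-inv) ⟩
        q^ (M ∸ p) * (gauss R q M a * (invGF (withMaxAt p f) a * invGF g b))
          ≡⟨ cong (λ e → q^ e * (gauss R q M a * (invGF (withMaxAt p f) a * invGF g b))) M∸p≡ ⟩
        q^ (b +ℕ (a ∸ p)) * (gauss R q M a * (invGF (withMaxAt p f) a * invGF g b))
          ≈⟨ *-congʳ (pow-+ b (a ∸ p)) ⟩
        q^ b * q^ (a ∸ p) * (gauss R q M a * (invGF (withMaxAt p f) a * invGF g b))
          ≈⟨ solve 5 (λ B E G W I → B :* E :* (G :* (W :* I)) := B :* G :* I :* (E :* W)) ≈-refl _ _ _ _ _ ⟩
        K * (q^ (a ∸ p) * invGF (withMaxAt p f) a) ∎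
        where
        M∸p≡ : M ∸ p ≡ b +ℕ (a ∸ p)
        M∸p≡ = trans (cong (_∸ p) (trans (sym a+b≡M) (ℕₚ.+-comm a b))) (ℕₚ.+-∸-assoc b p≤a)

    shuffle-right : ∀ {M a b f g} → ShuffleIdentity M → a +ℕ b ≡ suc M →
      OrderInvariant f → OrderInvariant g →
      ∑ (upTo b) (λ j → ∑ (insertions M) (splitWeight a f g ∘ insertAt (a +ℕ j) M))
        ≈ gauss R q M a * (invGF f a * invGF g b)
    shuffle-right {M} {a} {zero} _ a+0≡1+M _ _ = ≈-sym (≈-trans (*-congʳ (gauss-big M<a)) (zeroˡ _))
      where
      M<a : M < a
      M<a = subst (M <_) (trans (sym a+0≡1+M) (ℕₚ.+-identityʳ a)) ℕₚ.≤-refl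
    shuffle-right {M} {a} {suc b} {f} {g} shuffle-M a+1+b≡1+M f-inv g-inv = begin
      ∑ (upTo (suc b)) (λ j → ∑ (insertions M) (splitWeight a f g ∘ insertAt (a +ℕ j) M))
        ≈⟨ ∑-cong (upTo (suc b)) (λ j∈ → insert-right _ (ℕₚ.≤-pred (∈-upTo⁻ j∈))) ⟩
      ∑ (upTo (suc b)) (λ j → K * (q^ (b ∸ j) * invGF (withMaxAt j g) b))
        ≈⟨ ∑-*ˡ K (upTo (suc b)) _ ⟨
      K * ∑ (upTo (suc b)) (λ j → q^ (b ∸ j) * invGF (withMaxAt j g) b)
        ≈⟨ *-congˡ (invGF-suc g-inv b) ⟨
      K * invGF g (suc b)
        ≈⟨ *-assoc _ _ _ ⟩
      gauss R q M a * (invGF f a * invGF g (suc b)) ∎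
      where
      K = gauss R q M a * invGF f a
      a+b≡M : a +ℕ b ≡ M
      a+b≡M = ℕₚ.suc-injective (trans (sym (ℕₚ.+-suc a b)) a+1+b≡1+M)
      term : ∀ j → ∀ {σ} → σ ∈ insertions M →
             splitWeight a f g (insertAt (a +ℕ j) M σ) ≈ q^ (b ∸ j) * splitWeight a f (withMaxAt j g) σ
      term j {σ} σ∈ = begin
        f (take a (insertAt (a +ℕ j) M σ)) * g (drop a (insertAt (a +ℕ j) M σ)) * q^ inv (insertAt (a +ℕ j) M σ)
          ≡⟨ cong₂ (λ t d → f t * g d * q^ inv (insertAt (a +ℕ j) M σ))
                   (take-insertAt-+ a j M σ a≤σ) (drop-insertAt-+ a j M σ a≤σ) ⟩
        f (take a σ) * g (insertAt j M (drop a σ)) * q^ inv (insertAt (a +ℕ j) M σ)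
          ≈⟨ *-cong (*-congˡ (withMaxAt-insertAt j g-inv (drop a σ) (drop⁺ a (IsPermutation.bounded σ-perm))))
                    (pow-inv-insertAt-max (a +ℕ j) σ-perm) ⟩
        f (take a σ) * withMaxAt j g (drop a σ) * (q^ (M ∸ (a +ℕ j)) * q^ inv σ)
          ≡⟨ cong (λ e → f (take a σ) * withMaxAt j g (drop a σ) * (q^ e * q^ inv σ)) M∸[a+j]≡ ⟩
        f (take a σ) * withMaxAt j g (drop a σ) * (q^ (b ∸ j) * q^ inv σ)
          ≈⟨ solve 4 (λ F G P I → F :* G :* (P :* I) := P :* (F :* G :* I)) ≈-refl _ _ _ _ ⟩
        q^ (b ∸ j) * splitWeight a f (withMaxAt j g) σ ∎
        where
        σ-perm = ∈-insertions⁻ σ∈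
        a≤σ : a ≤ length σ
        a≤σ = subst (a ≤_) (trans a+b≡M (sym (IsPermutation.length≡ σ-perm))) (ℕₚ.m≤m+n a b)
        M∸[a+j]≡ : M ∸ (a +ℕ j) ≡ b ∸ j
        M∸[a+j]≡ = trans (cong (_∸ (a +ℕ j)) (sym a+b≡M)) (ℕₚ.[m+n]∸[m+o]≡n∸o a b j)
      insert-right : ∀ j → j ≤ b →
        ∑ (insertions M) (splitWeight a f g ∘ insertAt (a +ℕ j) M)
          ≈ K * (q^ (b ∸ j) * invGF (withMaxAt j g) b)
      insert-right j j≤b = begin
        ∑ (insertions M) (splitWeight a f g ∘ insertAt (a +ℕ j) M)
          ≈⟨ ∑-cong (insertions M) (term j) ⟩
        ∑ (insertions M) (λ σ → q^ (b ∸ j) * splitWeight a f (withMaxAt j g) σ)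
          ≈⟨ ∑-*ˡ _ (insertions M) _ ⟨
        q^ (b ∸ j) * ∑ (insertions M) (splitWeight a f (withMaxAt j g))
          ≈⟨ *-congˡ (shuffle-M a b a+b≡M f-inv (withMaxAt-invariant j g-inv)) ⟩
        q^ (b ∸ j) * (gauss R q M a * (invGF f a * invGF (withMaxAt j g) b))
          ≈⟨ solve 4 (λ E G F W → E :* (G :* (F :* W)) := G :* F :* (E :* W)) ≈-refl _ _ _ _ ⟩
        K * (q^ (b ∸ j) * invGF (withMaxAt j g) b) ∎

    shuffle : ∀ N → ShuffleIdentity N
    shuffle zero    zero    zero    refl {f} {g} _ _ =
      solve 2 (λ F G → F :* G :* con 1 :+ con 0 := con 1 :* ((F :* con 1 :+ con 0) :* (G :* con 1 :+ con 0)))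
            ≈-refl (f []) (g [])
    shuffle (suc M) zero    b 0+b≡1+M {f} {g} f-inv g-inv = begin
      ∑ (insertions (suc M)) (splitWeight 0 f g)
        ≈⟨ ∑-insertions-split 0 b 0+b≡1+M _ ⟩
      0# + ∑ (upTo b) (λ j → ∑ (insertions M) (splitWeight 0 f g ∘ insertAt j M))
        ≈⟨ +-identityˡ _ ⟩
      ∑ (upTo b) (λ j → ∑ (insertions M) (splitWeight 0 f g ∘ insertAt j M))
        ≈⟨ shuffle-right (shuffle M) 0+b≡1+M f-inv g-inv ⟩
      gauss R q M 0 * (invGF f 0 * invGF g b)
        ≡⟨ cong (_* (invGF f 0 * invGF g b)) (gauss-zero M) ⟩
      1# * (invGF f 0 * invGF g b) ∎
    shuffle (suc M) (suc a) b 1+a+b≡1+M {f} {g} f-inv g-inv = begin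
      ∑ (insertions (suc M)) (splitWeight (suc a) f g)
        ≈⟨ ∑-insertions-split (suc a) b 1+a+b≡1+M _ ⟩
      ∑ (upTo (suc a)) (λ p → ∑ (insertions M) (splitWeight (suc a) f g ∘ insertAt p M))
        + ∑ (upTo b) (λ j → ∑ (insertions M) (splitWeight (suc a) f g ∘ insertAt (suc a +ℕ j) M))
        ≈⟨ +-cong (shuffle-left (shuffle M) a+b≡M f-inv g-inv)
                  (shuffle-right (shuffle M) 1+a+b≡1+M f-inv g-inv) ⟩
      q^ b * gauss R q M a * X + gauss R q M (suc a) * X
        ≈⟨ distribʳ X _ _ ⟨
      (q^ b * gauss R q M a + gauss R q M (suc a)) * X
        ≡⟨ cong (λ e → (q^ e * gauss R q M a + gauss R q M (suc a)) * X) M∸a≡b ⟨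
      (q^ (M ∸ a) * gauss R q M a + gauss R q M (suc a)) * X
        ≈⟨ *-congʳ (gauss-suc-suc′ M a (subst (a ≤_) a+b≡M (ℕₚ.m≤m+n a b))) ⟨
      gauss R q (suc M) (suc a) * X ∎
      where
      X = invGF f (suc a) * invGF g b
      a+b≡M : a +ℕ b ≡ M
      a+b≡M = ℕₚ.suc-injective 1+a+b≡1+M
      M∸a≡b : M ∸ a ≡ b
      M∸a≡b = trans (cong (_∸ a) (sym a+b≡M)) (ℕₚ.m+n∸m≡n a b)

    -- The recurrence

    module _ (k : ℕ) .{{_ : NonZero k}} (2≤k : 2 ≤ k) where

      χdes : ℕ → List ℕ → Carrier
      χdes i σ = chiB R (descOK k i σ)

      χdes-invariant : ∀ i → OrderInvariant (χdes i)
      χdes-invariant i s = ≈-reflexive (cong (chiB R) (descOK-SamePattern k i s))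

      qEuler≈invGF : ∀ n → qEuler R q n k ≈ invGF (χdes 1) n
      qEuler≈invGF n =
        ≈-trans (∑-filterB (hasDesSet k) (perms n) (q^_ ∘ inv)) (∑-↭ _ (perms↭insertions n))

      splitTerm : ℕ → ℕ → Carrier
      splitTerm n p =
        q^ (n ∸ p) * (gauss R q n p * (invGF (χdes 1) p * invGF (χdes (suc (p +ℕ 1))) (n ∸ p)))

      weight-insertAt-inner : ∀ p {n σ} → IsPermutation n σ → p < n →
        χdes 1 (insertAt p n σ) * q^ inv (insertAt p n σ)
          ≈ chiB R ⌊ k ∣? p +ℕ 1 ⌋ * (q^ (n ∸ p) * splitWeight p (χdes 1) (χdes (suc (p +ℕ 1))) σ)
      weight-insertAt-inner p {σ = σ} σ-perm@(isPermutation refl σ< _) p<n = begin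
        chiB R (descOK k 1 (insertAt p (length σ) σ)) * q^ inv (insertAt p (length σ) σ)
          ≡⟨ cong (λ b → chiB R b * q^ inv (insertAt p (length σ) σ))
                  (descOK-insertAt-inner 2≤k p σ σ< p<n) ⟩
        chiB R (c ∧ (a ∧ d)) * q^ inv (insertAt p (length σ) σ)
          ≈⟨ *-cong (≈-trans (chiB-∧ c (a ∧ d)) (*-congˡ (chiB-∧ a d))) (pow-inv-insertAt-max p σ-perm) ⟩
        chiB R c * (chiB R a * chiB R d) * (q^ (length σ ∸ p) * q^ inv σ)
          ≈⟨ solve 5 (λ C A D P I → C :* (A :* D) :* (P :* I) := C :* (P :* (A :* D :* I)))
                     ≈-refl _ _ _ _ _ ⟩
        chiB R c * (q^ (length σ ∸ p) * splitWeight p (χdes 1) (χdes (suc (p +ℕ 1))) σ) ∎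
        where
        c = ⌊ k ∣? p +ℕ 1 ⌋
        a = descOK k 1 (take p σ)
        d = descOK k (suc (p +ℕ 1)) (drop p σ)

      weight-insertAt-last : ∀ {n σ} → IsPermutation n σ → 1 ≤ n →
        χdes 1 (insertAt n n σ) * q^ inv (insertAt n n σ)
          ≈ chiB R (not ⌊ k ∣? n ⌋) * (χdes 1 σ * q^ inv σ)
      weight-insertAt-last {σ = σ} σ-perm@(isPermutation refl σ< _) 1≤n = begin
        chiB R (descOK k 1 (insertAt n n σ)) * q^ inv (insertAt n n σ)
          ≡⟨ cong (λ b → chiB R b * q^ inv (insertAt n n σ)) (descOK-insertAt-last k σ σ< 1≤n) ⟩
        chiB R (not ⌊ k ∣? n ⌋ ∧ descOK k 1 σ) * q^ inv (insertAt n n σ)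
          ≈⟨ *-cong (chiB-∧ (not ⌊ k ∣? n ⌋) (descOK k 1 σ)) (pow-inv-insertAt-max n σ-perm) ⟩
        chiB R (not ⌊ k ∣? n ⌋) * χdes 1 σ * (q^ (n ∸ n) * q^ inv σ)
          ≡⟨ cong (λ e → chiB R (not ⌊ k ∣? n ⌋) * χdes 1 σ * (q^ e * q^ inv σ)) (ℕₚ.n∸n≡0 n) ⟩
        chiB R (not ⌊ k ∣? n ⌋) * χdes 1 σ * (1# * q^ inv σ)
          ≈⟨ solve 3 (λ C H I → C :* H :* (con 1 :* I) := C :* (H :* I)) ≈-refl _ _ _ ⟩
        chiB R (not ⌊ k ∣? n ⌋) * (χdes 1 σ * q^ inv σ) ∎
        where n = length σ

      ∑-insertAt-inner : ∀ {n p} → p < n →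
        ∑ (insertions n) (λ σ → χdes 1 (insertAt p n σ) * q^ inv (insertAt p n σ))
          ≈ chiB R ⌊ k ∣? p +ℕ 1 ⌋ * splitTerm n p
      ∑-insertAt-inner {n} {p} p<n = begin
        ∑ (insertions n) (λ σ → χdes 1 (insertAt p n σ) * q^ inv (insertAt p n σ))
          ≈⟨ ∑-cong (insertions n) (λ σ∈ → weight-insertAt-inner p (∈-insertions⁻ σ∈) p<n) ⟩
        ∑ (insertions n) (λ σ → χ * (q^ (n ∸ p) * splitWeight p D₁ Dₚ σ))
          ≈⟨ ∑-*ˡ χ (insertions n) _ ⟨
        χ * ∑ (insertions n) (λ σ → q^ (n ∸ p) * splitWeight p D₁ Dₚ σ)
          ≈⟨ *-congˡ (∑-*ˡ _ (insertions n) _) ⟨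
        χ * (q^ (n ∸ p) * ∑ (insertions n) (splitWeight p D₁ Dₚ))
          ≈⟨ *-congˡ (*-congˡ (shuffle n p (n ∸ p) (ℕₚ.m+[n∸m]≡n (ℕₚ.<⇒≤ p<n))
                                       (χdes-invariant 1) (χdes-invariant _))) ⟩
        χ * splitTerm n p ∎
        where
        χ  = chiB R ⌊ k ∣? p +ℕ 1 ⌋
        D₁ = χdes 1
        Dₚ = χdes (suc (p +ℕ 1))

      ∑-insertAt-last : ∀ {n} → 1 ≤ n →
        ∑ (insertions n) (λ σ → χdes 1 (insertAt n n σ) * q^ inv (insertAt n n σ))
          ≈ chiB R (not ⌊ k ∣? n ⌋) * qEuler R q n k
      ∑-insertAt-last {n} 1≤n = begin
        ∑ (insertions n) (λ σ → χdes 1 (insertAt n n σ) * q^ inv (insertAt n n σ))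
          ≈⟨ ∑-cong (insertions n) (λ σ∈ → weight-insertAt-last (∈-insertions⁻ σ∈) 1≤n) ⟩
        ∑ (insertions n) (λ σ → chiB R (not ⌊ k ∣? n ⌋) * (χdes 1 σ * q^ inv σ))
          ≈⟨ ∑-*ˡ _ (insertions n) _ ⟨
        chiB R (not ⌊ k ∣? n ⌋) * invGF (χdes 1) n
          ≈⟨ *-congˡ (qEuler≈invGF n) ⟨
        chiB R (not ⌊ k ∣? n ⌋) * qEuler R q n k ∎

      splitTerm-multiple : ∀ {n c} → k ∣ c → 1 ≤ c → c ≤ n →
        splitTerm n (c ∸ 1)
          ≈ gauss R q n (c ∸ 1) * q^ (n ∸ c +ℕ 1) * qEuler R q (c ∸ 1) k * qEuler R q (n ∸ c +ℕ 1) k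
      splitTerm-multiple {n} {c} k∣c 1≤c c≤n = begin
        q^ (n ∸ (c ∸ 1)) * (G * (E (c ∸ 1) * invGF (χdes (suc (c ∸ 1 +ℕ 1))) (n ∸ (c ∸ 1))))
          ≡⟨ cong₂ (λ e i → q^ e * (G * (E (c ∸ 1) * invGF (χdes i) e))) (m∸[n∸1]≡m∸n+1 1≤c c≤n) index≡ ⟩
        q^ (n ∸ c +ℕ 1) * (G * (E (c ∸ 1) * invGF (χdes (c +ℕ 1)) (n ∸ c +ℕ 1)))
          ≈⟨ *-congˡ (*-congˡ (*-cong (≈-sym (qEuler≈invGF (c ∸ 1))) suffix)) ⟩
        q^ (n ∸ c +ℕ 1) * (G * (qEuler R q (c ∸ 1) k * qEuler R q (n ∸ c +ℕ 1) k))
          ≈⟨ solve 4 (λ P G E F → P :* (G :* (E :* F)) := G :* P :* E :* F) ≈-refl _ _ _ _ ⟩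
        G * q^ (n ∸ c +ℕ 1) * qEuler R q (c ∸ 1) k * qEuler R q (n ∸ c +ℕ 1) k ∎
        where
        G = gauss R q n (c ∸ 1)
        E = invGF (χdes 1)
        index≡ : suc (c ∸ 1 +ℕ 1) ≡ c +ℕ 1
        index≡ = trans (cong suc (ℕₚ.m∸n+n≡m 1≤c)) (ℕₚ.+-comm 1 c)
        suffix : invGF (χdes (c +ℕ 1)) (n ∸ c +ℕ 1) ≈ qEuler R q (n ∸ c +ℕ 1) k
        suffix = ≈-trans (invGF-cong (λ σ → ≈-reflexive (cong (chiB R) (descOK-periodic k c 1 σ k∣c)))
                                     (n ∸ c +ℕ 1))
                         (≈-sym (qEuler≈invGF (n ∸ c +ℕ 1)))

      qEuler-zero : qEuler R q 0 k ≈ 1#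
      qEuler-zero = +-identityʳ 1#

      qEuler-suc : ∀ n → 1 ≤ n → qEuler R q (suc n) k ≈ rhs21 R q n k
      qEuler-suc n 1≤n = begin
        qEuler R q (suc n) k
          ≈⟨ qEuler≈invGF (suc n) ⟩
        invGF (χdes 1) (suc n)
          ≈⟨ ∑-insertions-suc n _ ⟩
        ∑ (upTo (suc n)) I
          ≈⟨ ∑-upTo-suc n I ⟩
        ∑ (upTo n) I + I n
          ≈⟨ +-cong (∑-cong (upTo n) (∑-insertAt-inner ∘ ∈-upTo⁻)) (∑-insertAt-last 1≤n) ⟩
        ∑ (upTo n) (λ p → chiB R ⌊ k ∣? p +ℕ 1 ⌋ * splitTerm n p) + χ * qEuler R q n k
          ≈⟨ +-congʳ (∑-multiples k n (splitTerm n)) ⟩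
        ∑ (map suc (upTo (n / k))) (λ m → splitTerm n (m *ℕ k ∸ 1)) + χ * qEuler R q n k
          ≈⟨ +-congʳ (∑-cong (map suc (upTo (n / k))) multiple) ⟩
        rhs21 R q n k ∎
        where
        I : ℕ → Carrier
        I p = ∑ (insertions n) (λ σ → χdes 1 (insertAt p n σ) * q^ inv (insertAt p n σ))
        χ = chiB R (not ⌊ k ∣? n ⌋)
        multiple : ∀ {m} → m ∈ map suc (upTo (n / k)) →
          splitTerm n (m *ℕ k ∸ 1) ≈ gauss R q n (m *ℕ k ∸ 1) * q^ (n ∸ m *ℕ k +ℕ 1)
                                     * qEuler R q (m *ℕ k ∸ 1) k * qEuler R q (n ∸ m *ℕ k +ℕ 1) k
        multiple m∈ with m′ , m′∈ , refl ← ∈-map⁻ suc m∈ =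
          splitTerm-multiple (n∣m*n (suc m′))
            (ℕₚ.≤-trans (ℕₚ.≤-trans (s≤s z≤n) 2≤k) (ℕₚ.m≤m+n k (m′ *ℕ k)))
            (ℕₚ.≤-trans (ℕₚ.*-monoˡ-≤ k (∈-upTo⁻ m′∈)) (m/n*n≤m n k))

proposition2p1 : (R : CommutativeSemiring 0ℓ 0ℓ) (q : CommutativeSemiring.Carrier R)
    → (k : ℕ) → .{{_ : NonZero k}} → 2 ≤ k
    → CommutativeSemiring._≈_ R (qEuler R q 0 k) (CommutativeSemiring.1# R)
      × ((n : ℕ) → 1 ≤ n
         → CommutativeSemiring._≈_ R (qEuler R q (suc n) k) (rhs21 R q n k))
proposition2p1 R q k 2≤k = qEuler-zero R q k 2≤k , qEuler-suc R q k 2≤k
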